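{- Let $E$ be a finite set, $\mathbb{I}=(S,(R_e)_{e\in E})$ an $\mathsf{E}$-graph, $N\ge2$, and $\mathbb{G}$ an $\mathsf{E}$-group compatible with $\mathbb{I}$. If $\mathbb{G}$ is $N$-acyclic and free over $\mathbb{I}$, then $\mathbb{G}$ is $N$-acyclic over $\mathbb{I}$.
   Context: An $\mathsf{E}$-graph is $(V,(R_e)_{e\in E})$ with each $R_e$ symmetric and each vertex having at most one $R_e$-neighbour; $\pi_e$ swaps the ends of $R_e$-edges and fixes other vertices; $[w]_{\mathbb{H}}=\pi_{e_n}\circ\cdots\circ\pi_{e_1}$. An $\mathsf{E}$-group is a group $\mathbb{G}=(G,\cdot,1)$ containing $E$ as pairwise distinct non-trivial involutions generating it; $[w]_{\mathbb{G}}=e_1\cdots e_n$; $\mathbb{G}[\gamma]$ is the subgroup generated by $\gamma\subseteq E$. $\mathbb{G}$ is compatible with $\mathbb{I}$ if $[w]_{\mathbb{G}}=1$ implies $[w]_{\mathbb{I}}=\mathrm{id}_S$. A (plain) coset cycle of length $n\ge2$ is $(g_i\mathbb{G}[\alpha_i],g_i)_{i\in\mathbb{Z}_n}$ with $\alpha_i\subseteq E$, $g_{i+1}\in g_i\mathbb{G}[\alpha_i]$ and $g_i\mathbb{G}[\alpha_i\cap\alpha_{i-1}]\cap g_{i+1}\mathbb{G}[\alpha_i\cap\alpha_{i+1}]=\emptyset$ for all $i$; $\mathbb{G}$ is $N$-acyclic if it has none of length $2\le n\le N$. For $\gamma\subseteq E$, $s,t\in S$: $\gamma^*[\mathbb{I},s]$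 is the set of words $w=e_1\cdots e_n\in\gamma^*$ labelling a walk $s=s_0,\dots,s_n$ in $\mathbb{I}$ (with $(s_{j-1},s_j)\in R_{e_j}$), and $\gamma^*[\mathbb{I},s,t]$ those whose walk ends at $t$; $\mathbb{G}[\mathbb{I},\gamma,s;g]:=\{g[w]_{\mathbb{G}}:w\in\gamma^*[\mathbb{I},s]\}$. For $g'=g[w]_{\mathbb{G}}$ with $w\in\gamma^*[\mathbb{I},s]$, $\ell(g')$ is the endpoint of the walk from $s$ labelled $w$ (well-defined by compatibility). $\mathbb{G}[\mathbb{I},\gamma,s;g]$ is free if for all $g_1,g_2$ in it and $\alpha_1,\alpha_2\subsetneq\gamma$: $g_1\mathbb{G}[\alpha_1]\cap g_2\mathbb{G}[\alpha_2]\neq\emptyset$ implies $\mathbb{G}[\mathbb{I},\alpha_1,\ell(g_1);g_1]\cap\mathbb{G}[\mathbb{I},\alpha_2,\ell(g_2);g_2]\ne\emptyset$; $\mathbb{G}$ is free over $\mathbb{I}$ if all $\mathbb{G}[\mathbb{I},\gamma,s;g]$ ($\gamma\subseteq E$, $s\in S$, $g\in G$) are free. An $\mathbb{I}$-coset cycle of length $n\ge2$ is $(\mathbb{G}[\mathbb{I},\alpha_i,s_i;g_i],g_i)_{i\in\mathbb{Z}_n}$ with $\alpha_i\subsetneq E$, $s_i\in S$, $g_i\in G$, such that for all $i$: $g_{i+1}=g_i[w]_{\mathbb{G}}$ for some $w\in\alpha_i^*[\mathbb{I},s_i,s_{i+1}]$, and $\mathbb{G}[\mathbb{I},\alpha_i\cap\alpha_{i-1},s_i;g_i]\cap\mathbb{G}[\mathbb{I},\alpha_i\cap\alpha_{i+1},s_{i+1};g_{i+1}]=\emptyset$.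 $\mathbb{G}$ is $N$-acyclic over $\mathbb{I}$ if it has no $\mathbb{I}$-coset cycle of length at most $N$. -}

module Defs where

open import Level using (Level; _⊔_; suc)
open import Data.Nat using (ℕ; _+_; _≤_; NonZero) renaming (suc to sucℕ)
open import Data.Nat.DivMod using (_mod_)
open import Data.Fin using (Fin; toℕ)
open import Data.Fin.Subset using (Subset; _∈_; _∩_; _⊂_; ⊤)
open import Data.List using (List; []; _∷_; foldr)
open import Data.List.Relation.Unary.All using (All)
open import Data.Product using (Σ; ∃; _×_; _,_)
open import Data.Empty using (⊥)
open import Relation.Nullary using (¬_)
open import Relation.Binary.PropositionalEquality using (_≡_)
open import Algebra.Bundles using (Group)

-- The finite set E is represented as Fin m.

record EGraph (m : ℕ) (s : Level) : Set (suc s) where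
  field
    V      : Set s
    R      : Fin m → V → V → Set s
    R-sym  : ∀ {e x y} → R e x y → R e y x
    R-uniq : ∀ {e x y z} → R e x y → R e x z → y ≡ z

module _ {m : ℕ} {s : Level} (I : EGraph m s) where
  open EGraph I

  -- graph of the permutation π_e : swaps ends of R_e-edges, fixes other vertices
  Pi : Fin m → V → V → Set s
  Pi e x y = R e x y ⊎' (y ≡ x × ¬ (∃ λ z → R e x z))
    where
      open import Data.Sum using () renaming (_⊎_ to _⊎'_)

  -- graph of [w]_I = π_{e_n} ∘ ⋯ ∘ π_{e_1}  (w = e_1 ⋯ e_n)
  data WordPerm : List (Fin m) → V → V → Set s where
    wp-nil  : ∀ {x} → WordPerm [] x x
    wp-cons : ∀ {e w x y z} → Pi e x y → WordPerm w y z → WordPerm (e ∷ w) x z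

  IsIdPerm : List (Fin m) → Set s
  IsIdPerm w = ∀ {x y} → WordPerm w x y → y ≡ x

  data Walk : V → List (Fin m) → V → Set s where
    walk-nil  : ∀ {x} → Walk x [] x
    walk-cons : ∀ {e w x y z} → R e x y → Walk y w z → Walk x (e ∷ w) z

record EGroup (m : ℕ) (c ℓ : Level) : Set (suc (c ⊔ ℓ)) where
  field
    group : Group c ℓ
  open Group group public
  field
    gen        : Fin m → Carrier
    gen-inj    : ∀ {e e'} → gen e ≈ gen e' → e ≡ e'
    gen-nontriv : ∀ e → ¬ (gen e ≈ ε)
    gen-invol  : ∀ e → gen e ∙ gen e ≈ ε

  ⟦_⟧ : List (Fin m) → Carrier
  ⟦ w ⟧ = foldr (λ e g → gen e ∙ g) ε w

  field
    generates : ∀ g → ∃ λ (w : List (Fin m)) → g ≈ ⟦ w ⟧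

_* : ∀ {m} → Subset m → List (Fin m) → Set
(γ *) w = All (_∈ γ) w

nextℤ : ∀ {n} .{{_ : NonZero n}} → Fin n → Fin n
nextℤ {n} i = sucℕ (toℕ i) mod n

prevℤ : ∀ {n} .{{_ : NonZero n}} → Fin n → Fin n
prevℤ {sucℕ k} i = (toℕ i + k) mod (sucℕ k)

module _ {m : ℕ} {c ℓ : Level} where

  module _ (𝔾 : EGroup m c ℓ) where
    open EGroup 𝔾

    InCoset : Carrier → Subset m → Carrier → Set ℓ
    InCoset g α x = ∃ λ w → (α *) w × x ≈ g ∙ ⟦ w ⟧

    Meet : ∀ {a b} → (Carrier → Set a) → (Carrier → Set b) → Set (c ⊔ a ⊔ b)
    Meet P Q = ∃ λ x → P x × Q x

    record CosetCycle (n : ℕ) .{{_ : NonZero n}} : Set (c ⊔ ℓ) where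
      field
        g     : Fin n → Carrier
        α     : Fin n → Subset m
        step  : ∀ i → InCoset (g i) (α i) (g (nextℤ i))
        disj  : ∀ i → ¬ Meet (InCoset (g i) (α i ∩ α (prevℤ i)))
                             (InCoset (g (nextℤ i)) (α i ∩ α (nextℤ i)))

    NAcyclic : ℕ → Set (c ⊔ ℓ)
    NAcyclic N = ∀ n .{{nz : NonZero n}} → 2 ≤ n → n ≤ N → ¬ CosetCycle n

    module _ {s : Level} (I : EGraph m s) where
      open EGraph I

      Compatible : Set (ℓ ⊔ s)
      Compatible = ∀ w → ⟦ w ⟧ ≈ ε → IsIdPerm I w

      InICoset : Subset m → V → Carrier → Carrier → Set (ℓ ⊔ s)
      InICoset γ x g y = ∃ λ w → (γ *) w × (∃ λ t → Walk I x w t) × y ≈ g ∙ ⟦ w ⟧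

      -- 𝔾[I, γ, x; g] is free. Elements g_i = g[w_i]_G with w_i ∈ γ*[I,x]
      -- labelling a walk from x to t_i, so ℓ(g_i) = t_i.
      IsFree : Subset m → V → Carrier → Set (c ⊔ ℓ ⊔ s)
      IsFree γ x g =
        ∀ (w₁ w₂ : List (Fin m)) (t₁ t₂ : V) →
        (γ *) w₁ → Walk I x w₁ t₁ →
        (γ *) w₂ → Walk I x w₂ t₂ →
        ∀ (α₁ α₂ : Subset m) → α₁ ⊂ γ → α₂ ⊂ γ →
        Meet (InCoset (g ∙ ⟦ w₁ ⟧) α₁) (InCoset (g ∙ ⟦ w₂ ⟧) α₂) →
        Meet (InICoset α₁ t₁ (g ∙ ⟦ w₁ ⟧)) (InICoset α₂ t₂ (g ∙ ⟦ w₂ ⟧))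

      FreeOver : Set (c ⊔ ℓ ⊔ s)
      FreeOver = ∀ γ x g → IsFree γ x g

      record ICosetCycle (n : ℕ) .{{_ : NonZero n}} : Set (c ⊔ ℓ ⊔ s) where
        field
          g      : Fin n → Carrier
          α      : Fin n → Subset m
          v      : Fin n → V
          proper : ∀ i → α i ⊂ ⊤
          step   : ∀ i → ∃ λ w → (α i *) w × Walk I (v i) w (v (nextℤ i))
                                 × g (nextℤ i) ≈ g i ∙ ⟦ w ⟧
          disj   : ∀ i → ¬ Meet (InICoset (α i ∩ α (prevℤ i)) (v i) (g i))
                                (InICoset (α i ∩ α (nextℤ i)) (v (nextℤ i)) (g (nextℤ i)))

      NAcyclicOver : ℕ → Set (c ⊔ ℓ ⊔ s)
      NAcyclicOver N = ∀ n .{{nz : NonZero n}} → 2 ≤ n → n ≤ N → ¬ ICosetCycle n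

-- An 𝕀-coset cycle is already a plain coset cycle on the same group elements
-- and generator sets: only its disjointness conditions need checking. If the
-- two plain cosets at position i met, then either α_i lies in a neighbouring
-- α_{i±1}, and the step word from g_i to g_{i+1} (or its reverse) puts g_{i+1}
-- (or g_i) into both 𝕀-cosets, or both intersections are proper subsets of
-- α_i, and freeness of 𝔾[𝕀, α_i, v_i; g_i] turns the plain meeting point into
-- a common point of the 𝕀-cosets. Either way the 𝕀-cycle is contradicted.
module Submission where

open import Defs
open import Level using (Level)
open import Data.Nat using (ℕ; _≤_; NonZero)
open import Data.Fin.Subset using (Subset; _∩_; _⊆_; _⊂_; inside; outside)
open import Data.Fin.Subset.Properties using (out⊆; s⊆s; s⊂s; out⊂in; p∩q⊆p; x∈p∩q⁺)
open import Data.List using ([]; _∷_; _ʳ++_)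
open import Data.List.Relation.Unary.All using (All; []; _∷_)
import Data.List.Relation.Unary.All as All
open import Data.Vec using ([]; _∷_)
open import Data.Product using (_,_)
open import Data.Sum using (_⊎_; inj₁; inj₂)
import Data.Sum as Sum
open import Function using (id)
open import Relation.Nullary using (¬_)

⊆⊎∩⊂ : ∀ {m} (α β : Subset m) → α ⊆ β ⊎ α ∩ β ⊂ α
⊆⊎∩⊂ []            []            = inj₁ id
⊆⊎∩⊂ (outside ∷ α) (_       ∷ β) = Sum.map out⊆ s⊂s (⊆⊎∩⊂ α β)
⊆⊎∩⊂ (inside  ∷ α) (inside  ∷ β) = Sum.map s⊆s s⊂s (⊆⊎∩⊂ α β)
⊆⊎∩⊂ (inside  ∷ α) (outside ∷ β) = inj₂ (out⊂in (p∩q⊆p α β))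

*-⊆∩ : ∀ {m} {α β : Subset m} {w} → α ⊆ β → (α *) w → ((α ∩ β) *) w
*-⊆∩ α⊆β = All.map (λ e∈α → x∈p∩q⁺ (e∈α , α⊆β e∈α))

All-ʳ++ : ∀ {a p} {A : Set a} {P : A → Set p} {xs ys} → All P xs → All P ys → All P (xs ʳ++ ys)
All-ʳ++ []         pys = pys
All-ʳ++ (px ∷ pxs) pys = All-ʳ++ pxs (px ∷ pys)

module _ {m : ℕ} {s : Level} (I : EGraph m s) where
  open EGraph I

  Walk-ʳ++ : ∀ {x y z w u} → Walk I x w y → Walk I x u z → Walk I y (w ʳ++ u) z
  Walk-ʳ++ walk-nil          q = q
  Walk-ʳ++ (walk-cons r p) q = Walk-ʳ++ p (walk-cons (R-sym r) q)

module _ {m : ℕ} {c ℓ : Level} (𝔾 : EGroup m c ℓ) where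
  open EGroup 𝔾

  ⟦⟧-ʳ++ : ∀ w u → ⟦ w ⟧ ∙ ⟦ w ʳ++ u ⟧ ≈ ⟦ u ⟧
  ⟦⟧-ʳ++ []      u = identityˡ _
  ⟦⟧-ʳ++ (e ∷ w) u = begin
    (gen e ∙ ⟦ w ⟧) ∙ ⟦ w ʳ++ (e ∷ u) ⟧ ≈⟨ assoc _ _ _ ⟩
    gen e ∙ (⟦ w ⟧ ∙ ⟦ w ʳ++ (e ∷ u) ⟧) ≈⟨ ∙-congˡ (⟦⟧-ʳ++ w (e ∷ u)) ⟩
    gen e ∙ (gen e ∙ ⟦ u ⟧)             ≈⟨ assoc _ _ _ ⟨
    (gen e ∙ gen e) ∙ ⟦ u ⟧             ≈⟨ ∙-congʳ (gen-invol e) ⟩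
    ε ∙ ⟦ u ⟧                           ≈⟨ identityˡ _ ⟩
    ⟦ u ⟧                               ∎
    where open import Relation.Binary.Reasoning.Setoid setoid

  InCoset-resp : ∀ {g g' α x} → g ≈ g' → InCoset 𝔾 g α x → InCoset 𝔾 g' α x
  InCoset-resp g≈g' (w , w∈α* , x≈gw) = w , w∈α* , trans x≈gw (∙-congʳ g≈g')

  module _ {s : Level} (I : EGraph m s) where
    open EGraph I

    InICoset-resp : ∀ {g g' γ v x} → g ≈ g' → InICoset 𝔾 I γ v g x → InICoset 𝔾 I γ v g' x
    InICoset-resp g≈g' (w , w∈γ* , walk , x≈gw) = w , w∈γ* , walk , trans x≈gw (∙-congʳ g≈g')

    InICoset-refl : ∀ {γ v g} → InICoset 𝔾 I γ v g g
    InICoset-refl = [] , [] , (_ , walk-nil) , sym (identityʳ _)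

    InICoset-forward : ∀ {γ v v' g g' w} → (γ *) w → Walk I v w v' → g' ≈ g ∙ ⟦ w ⟧ →
                       InICoset 𝔾 I γ v g g'
    InICoset-forward w∈γ* walk g'≈gw = _ , w∈γ* , (_ , walk) , g'≈gw

    InICoset-backward : ∀ {γ v v' g g' w} → (γ *) w → Walk I v w v' → g' ≈ g ∙ ⟦ w ⟧ →
                        InICoset 𝔾 I γ v' g' g
    InICoset-backward {g = g} {g'} {w} w∈γ* walk g'≈gw =
      w ʳ++ [] , All-ʳ++ w∈γ* [] , (_ , Walk-ʳ++ I walk walk-nil) , sym g'w⁻¹≈g
      where
        open import Relation.Binary.Reasoning.Setoid setoid
        g'w⁻¹≈g : g' ∙ ⟦ w ʳ++ [] ⟧ ≈ g
        g'w⁻¹≈g = begin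
          g' ∙ ⟦ w ʳ++ [] ⟧           ≈⟨ ∙-congʳ g'≈gw ⟩
          (g ∙ ⟦ w ⟧) ∙ ⟦ w ʳ++ [] ⟧  ≈⟨ assoc _ _ _ ⟩
          g ∙ (⟦ w ⟧ ∙ ⟦ w ʳ++ [] ⟧)  ≈⟨ ∙-congˡ (⟦⟧-ʳ++ w []) ⟩
          g ∙ ε                       ≈⟨ identityʳ _ ⟩
          g                           ∎

    Meet-lift : FreeOver 𝔾 I → ∀ {α v v' g g' w} → (α *) w → Walk I v w v' → g' ≈ g ∙ ⟦ w ⟧ →
                ∀ β δ → Meet 𝔾 (InCoset 𝔾 g (α ∩ β)) (InCoset 𝔾 g' (α ∩ δ)) →
                Meet 𝔾 (InICoset 𝔾 I (α ∩ β) v g) (InICoset 𝔾 I (α ∩ δ) v' g')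
    Meet-lift free {α} {v} {v'} {g} {g'} {w} w∈α* walk g'≈gw β δ (x , x∈gβ , x∈g'δ)
      with ⊆⊎∩⊂ α β | ⊆⊎∩⊂ α δ
    ... | inj₁ α⊆β | _ =
      g' , InICoset-forward (*-⊆∩ α⊆β w∈α*) walk g'≈gw , InICoset-refl
    ... | inj₂ _ | inj₁ α⊆δ =
      g , InICoset-refl , InICoset-backward (*-⊆∩ α⊆δ w∈α*) walk g'≈gw
    ... | inj₂ αβ⊂α | inj₂ αδ⊂α
      with free α v g [] w v v' [] walk-nil w∈α* walk (α ∩ β) (α ∩ δ) αβ⊂α αδ⊂α
             (x , InCoset-resp (sym (identityʳ g)) x∈gβ , InCoset-resp g'≈gw x∈g'δ)
    ... | y , y∈gβ , y∈g'δ =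
      y , InICoset-resp (identityʳ g) y∈gβ , InICoset-resp (sym g'≈gw) y∈g'δ

    ICosetCycle⇒CosetCycle : FreeOver 𝔾 I → ∀ {n} .{{_ : NonZero n}} →
                             ICosetCycle 𝔾 I n → CosetCycle 𝔾 n
    ICosetCycle⇒CosetCycle free C = record { g = g ; α = α ; step = step′ ; disj = disj′ }
      where
        open ICosetCycle C
        step′ : ∀ i → InCoset 𝔾 (g i) (α i) (g (nextℤ i))
        step′ i with step i
        ... | w , w∈α* , _ , g⁺≈gw = w , w∈α* , g⁺≈gw
        disj′ : ∀ i → ¬ Meet 𝔾 (InCoset 𝔾 (g i) (α i ∩ α (prevℤ i)))
                               (InCoset 𝔾 (g (nextℤ i)) (α i ∩ α (nextℤ i)))
        disj′ i meet with step i
        ... | w , w∈α* , walk , g⁺≈gw =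
          disj i (Meet-lift free w∈α* walk g⁺≈gw (α (prevℤ i)) (α (nextℤ i)) meet)

lemma7p7 : ∀ {c ℓ s : Level} (m : ℕ) (I : EGraph m s) (N : ℕ) (𝔾 : EGroup m c ℓ) →
    2 ≤ N → Compatible 𝔾 I → NAcyclic 𝔾 N → FreeOver 𝔾 I → NAcyclicOver 𝔾 I N
lemma7p7 m I N 𝔾 _ _ acyclic free n 2≤n n≤N C =
  acyclic n 2≤n n≤N (ICosetCycle⇒CosetCycle 𝔾 I free C)
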